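{- Let $n\ge 6$ be an integer and let $G_{6+n}$ be the bipartite graph with stable sets $V_1=\{(0,j): j\in\mathbb{Z}_6\}$ and $V_2=\{(1,i): i=0,1,\ldots,n-1\}$, in which $(1,i)$ is adjacent to $(0,j)$ if and only if $j\equiv i$, $j\equiv i+1$, or $j\equiv i+3 \pmod 6$. Then $G_{6+n}$, which has $n+6$ vertices, has diameter $3$. -}

module Defs where

open import Data.Nat using (ℕ; zero; suc; _+_; _≤_; _<_)
open import Data.Nat.DivMod using (_%_)
open import Data.Fin using (Fin; toℕ)
open import Data.Sum using (_⊎_; inj₁; inj₂)
open import Data.Product using (Σ; _×_; ∃; ∃-syntax)
open import Data.Empty using (⊥)
open import Relation.Nullary using (¬_)
open import Relation.Binary.PropositionalEquality using (_≡_)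

record Graph : Set₁ where
  field
    V   : Set
    Adj : V → V → Set

open Graph public

data Walk (G : Graph) : V G → V G → ℕ → Set where
  here : ∀ {u} → Walk G u u zero
  step : ∀ {u w v k} → Adj G u w → Walk G w v k → Walk G u v (suc k)

IsDist : (G : Graph) → V G → V G → ℕ → Set
IsDist G u v d = Walk G u v d × (∀ k → k < d → ¬ Walk G u v k)

HasDiameter : Graph → ℕ → Set
HasDiameter G d =
  (∀ u v → ∃[ e ] (e ≤ d × IsDist G u v e)) ×
  (∃[ u ] ∃[ v ] IsDist G u v d)

-- The graph G_{6+n}: vertices (0,j), j ∈ ℤ₆  (inj₁ j) and (1,i), i < n  (inj₂ i).
-- (1,i) ~ (0,j) iff j ≡ i, i+1 or i+3 (mod 6).
Link : (n : ℕ) → Fin n → Fin 6 → Set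
Link n i j = (toℕ j ≡ toℕ i % 6) ⊎ (toℕ j ≡ (toℕ i + 1) % 6) ⊎ (toℕ j ≡ (toℕ i + 3) % 6)

GAdj : (n : ℕ) → Fin 6 ⊎ Fin n → Fin 6 ⊎ Fin n → Set
GAdj n (inj₁ j) (inj₁ j') = ⊥
GAdj n (inj₁ j) (inj₂ i)  = Link n i j
GAdj n (inj₂ i) (inj₁ j)  = Link n i j
GAdj n (inj₂ i) (inj₂ i') = ⊥

G : ℕ → Graph
G n = record { V = Fin 6 ⊎ Fin n ; Adj = GAdj n }

-- The neighbourhood {i, i+1, i+3} (mod 6) of (1,i) depends only on i mod 6, and n ≥ 6 makes all
-- six of these patterns occur. A finite check on ℤ₆ shows that any two patterns meet and that any
-- two points of ℤ₆ lie in a common pattern: this gives distance ≤ 2 within each side and, going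
-- through (0, i mod 6) ~ (1,i), distance ≤ 3 across. Since the graph is bipartite, a non-adjacent
-- pair across the sides, such as (0,2) and (1,0), is at distance exactly 3.
module Submission where

open import Defs
open import Data.Nat using (ℕ; suc; _+_; _≤_; _<_; z≤n; s≤s; NonZero)
open import Data.Nat.Properties using (m≤n⇒m≤1+n) renaming (_≟_ to _≟ℕ_)
open import Data.Nat.DivMod using (_%_; _mod_; m%n<n; %-distribˡ-+; m%n%n≡m%n)
open import Data.Fin using (Fin; toℕ; inject≤)
open import Data.Fin.Patterns using (0F; 2F)
open import Data.Fin.Properties using (toℕ-fromℕ<; toℕ-inject≤; any?; all?) renaming (_≟_ to _≟F_)
import Data.Sum as Sum
open import Data.Sum.Properties using (≡-dec)
open import Data.Sum using (_⊎_; inj₁; inj₂)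
open import Data.Product using (_×_; ∃-syntax; _,_; map₁; map₂)
open import Relation.Nullary using (¬_; Dec; yes; no)
open import Relation.Nullary.Decidable using (toWitness; ¬?; _⊎-dec_; _×-dec_; _→-dec_)
open import Relation.Binary.PropositionalEquality
  using (_≡_; _≢_; refl; sym; trans; cong; module ≡-Reasoning)

module _ {Γ : Graph} where

  private
    Vertex = V Γ

  walk₀⇒≡ : ∀ {u v : Vertex} → Walk Γ u v 0 → u ≡ v
  walk₀⇒≡ here = refl

  walk₁⇒adj : ∀ {u v : Vertex} → Walk Γ u v 1 → Adj Γ u v
  walk₁⇒adj (step a here) = a

  walk₂⇒common : ∀ {u v : Vertex} → Walk Γ u v 2 → ∃[ w ] (Adj Γ u w × Adj Γ w v)
  walk₂⇒common (step a (step b here)) = _ , a , b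

  isDist-refl : ∀ {u : Vertex} → IsDist Γ u u 0
  isDist-refl = here , λ _ ()

  isDist-one : ∀ {u v : Vertex} → u ≢ v → Adj Γ u v → IsDist Γ u v 1
  isDist-one u≢v a = step a here , λ { 0 _ p → u≢v (walk₀⇒≡ p) ; (suc _) (s≤s ()) _ }

  isDist-two : ∀ {u w v : Vertex} → u ≢ v → ¬ Adj Γ u v →
               Adj Γ u w → Adj Γ w v → IsDist Γ u v 2
  isDist-two u≢v ¬uv a b = step a (step b here) , shorter
    where
    shorter : ∀ k → k < 2 → ¬ Walk Γ _ _ k
    shorter 0 _ p = u≢v (walk₀⇒≡ p)
    shorter 1 _ p = ¬uv (walk₁⇒adj p)
    shorter (suc (suc _)) (s≤s (s≤s ())) _

  isDist-three : ∀ {u v : Vertex} → u ≢ v → ¬ Adj Γ u v →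
                 (∀ w → Adj Γ u w → ¬ Adj Γ w v) → Walk Γ u v 3 → IsDist Γ u v 3
  isDist-three u≢v ¬uv ¬common p = p , shorter
    where
    shorter : ∀ k → k < 3 → ¬ Walk Γ _ _ k
    shorter 0 _ q = u≢v (walk₀⇒≡ q)
    shorter 1 _ q = ¬uv (walk₁⇒adj q)
    shorter 2 _ q with walk₂⇒common q
    ... | w , a , b = ¬common w a b
    shorter (suc (suc (suc _))) (s≤s (s≤s (s≤s ()))) _

  dist≤2 : ∀ {u v : Vertex} → Dec (u ≡ v) → ¬ Adj Γ u v →
           (u ≢ v → ∃[ w ] (Adj Γ u w × Adj Γ w v)) →
           ∃[ e ] (e ≤ 2 × IsDist Γ u v e)
  dist≤2 (yes refl) _   _      = 0 , z≤n , isDist-refl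
  dist≤2 (no u≢v)   ¬uv common with common u≢v
  ... | _ , a , b = 2 , s≤s (s≤s z≤n) , isDist-two u≢v ¬uv a b

  module _ (adj-sym : ∀ {u v : Vertex} → Adj Γ u v → Adj Γ v u) where

    walk-snoc : ∀ {u v w : Vertex} {k} → Walk Γ u v k → Adj Γ v w → Walk Γ u w (suc k)
    walk-snoc here       a = step a here
    walk-snoc (step b p) a = step b (walk-snoc p a)

    walk-reverse : ∀ {u v : Vertex} {k} → Walk Γ u v k → Walk Γ v u k
    walk-reverse here       = here
    walk-reverse (step a p) = walk-snoc (walk-reverse p) (adj-sym a)

    isDist-sym : ∀ {u v : Vertex} {d} → IsDist Γ u v d → IsDist Γ v u d
    isDist-sym (p , shorter) = walk-reverse p , λ k k<d q → shorter k k<d (walk-reverse q)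

LinkFrom : ℕ → Fin 6 → Set
LinkFrom a j = (toℕ j ≡ a % 6) ⊎ (toℕ j ≡ (a + 1) % 6) ⊎ (toℕ j ≡ (a + 3) % 6)

+-%-congˡ : ∀ {a b} k d .{{_ : NonZero d}} → a % d ≡ b % d → (a + k) % d ≡ (b + k) % d
+-%-congˡ {a} {b} k d a≡b = begin
  (a + k) % d            ≡⟨ %-distribˡ-+ a k d ⟩
  (a % d + k % d) % d    ≡⟨ cong (λ x → (x + k % d) % d) a≡b ⟩
  (b % d + k % d) % d    ≡⟨ %-distribˡ-+ b k d ⟨
  (b + k) % d            ∎
  where open ≡-Reasoning

LinkFrom-mod : ∀ a b {j} → a % 6 ≡ b % 6 → LinkFrom a j → LinkFrom b j
LinkFrom-mod a b a≡b =
  Sum.map (λ e → trans e a≡b)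
          (Sum.map (λ e → trans e (+-%-congˡ {a} {b} 1 6 a≡b))
                   (λ e → trans e (+-%-congˡ {a} {b} 3 6 a≡b)))

Pattern : Fin 6 → Fin 6 → Set
Pattern r = LinkFrom (toℕ r)

pattern? : ∀ r j → Dec (Pattern r j)
pattern? r j = (toℕ j ≟ℕ toℕ r % 6) ⊎-dec (toℕ j ≟ℕ (toℕ r + 1) % 6) ⊎-dec (toℕ j ≟ℕ (toℕ r + 3) % 6)

pattern-refl : ∀ r → Pattern r r
pattern-refl = toWitness {a? = all? (λ r → pattern? r r)} _

patterns-intersect : ∀ r s → ∃[ j ] (Pattern r j × Pattern s j)
patterns-intersect =
  toWitness {a? = all? λ r → all? λ s → any? λ j → pattern? r j ×-dec pattern? s j} _

patterns-cover-pairs : ∀ j j' → j ≢ j' → ∃[ r ] (Pattern r j × Pattern r j')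
patterns-cover-pairs =
  toWitness {a? = all? λ j → all? λ j' →
                    ¬? (j ≟F j') →-dec any? λ r → pattern? r j ×-dec pattern? r j'} _

¬pattern-0-2 : ¬ Pattern 0F 2F
¬pattern-0-2 (inj₁ ())
¬pattern-0-2 (inj₂ (inj₁ ()))
¬pattern-0-2 (inj₂ (inj₂ ()))

¬pattern⇒≢ : ∀ {r j} → ¬ Pattern r j → j ≢ r
¬pattern⇒≢ ¬p refl = ¬p (pattern-refl _)

residue : ∀ {n} → Fin n → Fin 6
residue i = toℕ i mod 6

residue-% : ∀ {n} (i : Fin n) → toℕ (residue i) % 6 ≡ toℕ i % 6
residue-% i = trans (cong (_% 6) (toℕ-fromℕ< (m%n<n (toℕ i) 6))) (m%n%n≡m%n (toℕ i) 6)

link⇒pattern : ∀ {n} (i : Fin n) {j} → Link n i j → Pattern (residue i) j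
link⇒pattern i = LinkFrom-mod (toℕ i) (toℕ (residue i)) (sym (residue-% i))

pattern⇒link : ∀ {n} (i : Fin n) {j} → Pattern (residue i) j → Link n i j
pattern⇒link i = LinkFrom-mod (toℕ (residue i)) (toℕ i) (residue-% i)

G-sym : ∀ {n} {u v : V (G n)} → Adj (G n) u v → Adj (G n) v u
G-sym {u = inj₁ _} {inj₂ _} a = a
G-sym {u = inj₂ _} {inj₁ _} a = a

module _ (n : ℕ) (6≤n : 6 ≤ n) where

  lift : Fin 6 → Fin n
  lift r = inject≤ r 6≤n

  pattern⇒link-lift : ∀ r {j} → Pattern r j → Link n (lift r) j
  pattern⇒link-lift r = LinkFrom-mod (toℕ r) (toℕ (lift r)) (cong (_% 6) (sym (toℕ-inject≤ r 6≤n)))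

  inj₁-dist : ∀ j j' → ∃[ e ] (e ≤ 2 × IsDist (G n) (inj₁ j) (inj₁ j') e)
  inj₁-dist j j' = dist≤2 (≡-dec _≟F_ _≟F_ (inj₁ j) (inj₁ j')) (λ ()) common
    where
    common : inj₁ j ≢ inj₁ j' → ∃[ w ] (GAdj n (inj₁ j) w × GAdj n w (inj₁ j'))
    common j≢j' with patterns-cover-pairs j j' (λ { refl → j≢j' refl })
    ... | r , p , p' = inj₂ (lift r) , pattern⇒link-lift r p , pattern⇒link-lift r p'

  inj₂-dist : ∀ i i' → ∃[ e ] (e ≤ 2 × IsDist (G n) (inj₂ i) (inj₂ i') e)
  inj₂-dist i i' = dist≤2 (≡-dec _≟F_ _≟F_ (inj₂ i) (inj₂ i')) (λ ()) common
    where
    common : inj₂ i ≢ inj₂ i' → ∃[ w ] (GAdj n (inj₂ i) w × GAdj n w (inj₂ i'))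
    common _ with patterns-intersect (residue i) (residue i')
    ... | j , p , p' = inj₁ j , pattern⇒link i p , pattern⇒link i' p'

  -- The middle edge of a path (0,j) – (1,i') – (0,j') – (1,i) would join the two sides.
  cross-dist-three : ∀ {j i} → ¬ Link n i j → Walk (G n) (inj₁ j) (inj₂ i) 3 →
                     IsDist (G n) (inj₁ j) (inj₂ i) 3
  cross-dist-three ¬link = isDist-three (λ ()) ¬link no-common
    where
    no-common : ∀ w → GAdj n (inj₁ _) w → ¬ GAdj n w (inj₂ _)
    no-common (inj₂ _) _ ()

  -- Route through (1,r) for a pattern r containing both j and j'.
  cross-walk : ∀ j j' i → j ≢ j' → Link n i j' → Walk (G n) (inj₁ j) (inj₂ i) 3
  cross-walk j j' i j≢j' link with patterns-cover-pairs j j' j≢j'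
  ... | r , p , p' = step {w = inj₂ (lift r)} (pattern⇒link-lift r p)
                       (step {w = inj₁ j'} (pattern⇒link-lift r p') (step link here))

  cross-dist : ∀ j i → ∃[ e ] (e ≤ 3 × IsDist (G n) (inj₁ j) (inj₂ i) e)
  cross-dist j i with pattern? (residue i) j
  ... | yes p = 1 , s≤s z≤n , isDist-one (λ ()) (pattern⇒link i p)
  ... | no ¬p = 3 , s≤s (s≤s (s≤s z≤n)) ,
                cross-dist-three (λ l → ¬p (link⇒pattern i l))
                  (cross-walk j (residue i) i (¬pattern⇒≢ {residue i} {j} ¬p)
                              (pattern⇒link i (pattern-refl (residue i))))

  dist≤3 : ∀ u v → ∃[ e ] (e ≤ 3 × IsDist (G n) u v e)
  dist≤3 (inj₁ j) (inj₁ j') = map₂ (map₁ m≤n⇒m≤1+n) (inj₁-dist j j')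
  dist≤3 (inj₂ i) (inj₂ i') = map₂ (map₁ m≤n⇒m≤1+n) (inj₂-dist i i')
  dist≤3 (inj₁ j) (inj₂ i)  = cross-dist j i
  dist≤3 (inj₂ i) (inj₁ j)  = map₂ (map₂ (isDist-sym {G n} G-sym)) (cross-dist j i)

  dist-2-0 : IsDist (G n) (inj₁ 2F) (inj₂ (lift 0F)) 3
  dist-2-0 = cross-dist-three ¬link
               (cross-walk 2F 0F (lift 0F) (λ ()) (pattern⇒link-lift 0F (pattern-refl 0F)))
    where
    ¬link : ¬ Link n (lift 0F) 2F
    ¬link l = ¬pattern-0-2 (LinkFrom-mod (toℕ (lift 0F)) 0 (cong (_% 6) (toℕ-inject≤ 0F 6≤n)) l)

proposition5p1 : (n : ℕ) → 6 ≤ n → HasDiameter (G n) 3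
proposition5p1 n 6≤n = dist≤3 n 6≤n , inj₁ 2F , inj₂ (lift n 6≤n 0F) , dist-2-0 n 6≤n
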